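{- Let $A,B$ be states and let $H$ be a canonical $(A,B)$-difference graph. Then $H$ is realisable, i.e. there is a transition path $P$ from $A$ to $B$ with $\mathrm{diff}(P)=H$.
   Context: Let $R$ be a finite set of requests with a metric $d$ on them. States are subsets of $R$. The transition graph $G$ has an edge between states $S,S'$ whenever $S=S'\cup\{r,r'\}$ with $r,r'\notin S'$ distinct, of cost $d(r,r')$; such an edge is a transition that adds or removes the pair $\{r,r'\}$. A transition path is a path in $G$. An $(A,B)$-difference graph is a multigraph $H$ on vertex set $R$ such that every $r\in R$ has odd degree in $H$ iff $r\in A\triangle B$. For a transition path $P$ between $A$ and $B$, the $P$-difference graph $\mathrm{diff}(P)$ is the multigraph on $R$ in which the multiplicity of edge $(p,q)$ equals the number of transitions along $P$ that add or remove $\{p,q\}$; an $(A,B)$-difference graph is realisable if it equals $\mathrm{diff}(P)$ for some transition path $P$ between $A$ and $B$. An $(A,B)$-difference graph $H$ is canonical if it can be decomposed into $\ell=|A\triangle B|/2$ edge-disjoint paths $Q_1,\dots,Q_\ell$ between disjoint pairs $(p_i,q_i)$ of elements of $A\triangle B$ such that for each $i$: $Q_i$ is the single edge $(p_i,q_i)$ if both $p_i,q_i\in A\setminus B$ or both in $B\setminus A$, and $Q_i$ consists of two edges $(p_i,s),(s,q_i)$ for some other request $s$ if exactly one of $p_i,q_i$ lies in $A\setminus B$ and the other in $B\setminus A$. -}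

module Defs where

open import Data.Nat using (ℕ; zero; suc; _+_; _%_)
open import Data.Fin using (Fin)
open import Data.Fin.Subset using (Subset; _∈_; _∉_; _∪_; ⁅_⁆)
open import Data.Maybe using (Maybe; just; nothing)
open import Data.List using (List; []; _∷_; map)
open import Data.Nat.ListAction using (sum)
open import Data.List.Relation.Unary.Unique.Propositional using (Unique)
import Data.List.Membership.Propositional as LM
open import Data.List.Relation.Unary.All using (All)
open import Data.Vec.Functional using (foldr)
open import Data.Product using (Σ; _×_; _,_; ∃)
open import Data.Sum using (_⊎_)
open import Relation.Nullary using (¬_; yes; no)
open import Relation.Nullary.Decidable using (⌊_⌋)
open import Relation.Binary.PropositionalEquality using (_≡_; _≢_)
open import Data.Fin using (_≟_)
open import Data.Bool using (Bool; true; false; _∧_; _∨_)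
open import Function.Bundles using (_⇔_)

-- Requests are the elements of Fin n (a finite set R); states are subsets.
State : ℕ → Set
State n = Subset n

Transition : ∀ {n} → State n → State n → Fin n → Fin n → Set
Transition S S' r r' =
  r ≢ r' ×
  ( (r ∉ S' × r' ∉ S' × S ≡ (S' ∪ ⁅ r ⁆) ∪ ⁅ r' ⁆)
  ⊎ (r ∉ S × r' ∉ S × S' ≡ (S ∪ ⁅ r ⁆) ∪ ⁅ r' ⁆) )

data TransitionPath {n : ℕ} : State n → State n → Set where
  []   : ∀ {S} → TransitionPath S S
  step : ∀ {S S' T} (r r' : Fin n) → Transition S S' r r' →
         TransitionPath S' T → TransitionPath S T

-- Multigraphs on vertex set Fin n, given by edge multiplicities
-- (mult p p = number of loops at p).
record Multigraph (n : ℕ) : Set where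
  field
    mult : Fin n → Fin n → ℕ
    sym  : ∀ p q → mult p q ≡ mult q p
open Multigraph public

-- Degree of a vertex (a loop contributes 2).
degree : ∀ {n} → Multigraph n → Fin n → ℕ
degree {n} H v = foldr _+_ 0 (mult H v) + mult H v v

Odd : ℕ → Set
Odd k = k % 2 ≡ 1

_∈△_,_ : ∀ {n} → Fin n → State n → State n → Set
v ∈△ A , B = (v ∈ A × v ∉ B) ⊎ (v ∈ B × v ∉ A)

IsDifferenceGraph : ∀ {n} → State n → State n → Multigraph n → Set
IsDifferenceGraph A B H = ∀ v → Odd (degree H v) ⇔ (v ∈△ A , B)

pairIndicator : ∀ {n} → Fin n → Fin n → Fin n → Fin n → ℕ
pairIndicator p q x y with ⌊ p ≟ x ⌋ ∧ ⌊ q ≟ y ⌋ ∨ ⌊ p ≟ y ⌋ ∧ ⌊ q ≟ x ⌋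
... | true  = 1
... | false = 0

diffMult : ∀ {n} {A B : State n} → TransitionPath A B → Fin n → Fin n → ℕ
diffMult []               x y = 0
diffMult (step r r' _ P)  x y = pairIndicator r r' x y + diffMult P x y

_≈ᴹ_ : ∀ {n} → Multigraph n → Multigraph n → Set
_≈ᴹ_ {n} H K = ∀ (x y : Fin n) → mult H x y ≡ mult K x y

DiffIs : ∀ {n} {A B : State n} → TransitionPath A B → Multigraph n → Set
DiffIs P H = ∀ x y → diffMult P x y ≡ mult H x y

Realisable : ∀ {n} → State n → State n → Multigraph n → Set
Realisable A B H = Σ (TransitionPath A B) λ P → DiffIs P H

-- A path Q_i of a canonical decomposition: endpoints p, q and an optional
-- middle vertex s (nothing: the single edge (p,q); just s: edges (p,s),(s,q)).
record PathPiece (n : ℕ) : Set where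
  constructor piece
  field
    pEnd : Fin n
    qEnd : Fin n
    mid  : Maybe (Fin n)
open PathPiece public

pieceMult : ∀ {n} → PathPiece n → Fin n → Fin n → ℕ
pieceMult (piece p q nothing)  x y = pairIndicator p q x y
pieceMult (piece p q (just s)) x y = pairIndicator p s x y + pairIndicator s q x y

ValidPiece : ∀ {n} → State n → State n → PathPiece n → Set
ValidPiece A B (piece p q m) =
  p ≢ q ×
  ( (((p ∈ A × p ∉ B) × (q ∈ A × q ∉ B)) ⊎ ((p ∈ B × p ∉ A) × (q ∈ B × q ∉ A)))
      × m ≡ nothing
  ⊎ (((p ∈ A × p ∉ B) × (q ∈ B × q ∉ A)) ⊎ ((p ∈ B × p ∉ A) × (q ∈ A × q ∉ B)))
      × ∃ λ s → m ≡ just s × s ≢ p × s ≢ q )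

endpoints : ∀ {n} → List (PathPiece n) → List (Fin n)
endpoints []                   = []
endpoints (piece p q _ ∷ Qs)   = p ∷ q ∷ endpoints Qs

IsCanonical : ∀ {n} → State n → State n → Multigraph n → Set
IsCanonical {n} A B H =
  Σ (List (PathPiece n)) λ Qs →
    All (ValidPiece A B) Qs ×
    Unique (endpoints Qs) ×
    (∀ v → (v LM.∈ endpoints Qs) ⇔ (v ∈△ A , B)) ×
    (∀ x y → mult H x y ≡ sum (map (λ Q → pieceMult Q x y) Qs))

{-# OPTIONS --safe #-}
module Submission where

-- Every transition toggles the membership of its two requests. Realise the pieces
-- one after another: a piece (p , q) with p, q on the same side of A △ B is one
-- transition; a piece p – s – q with p, q on opposite sides is two transitions, s
-- being paired first with whichever endpoint currently agrees with it, so that s is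
-- toggled twice and restored. The endpoints are distinct and make up A △ B, so the
-- whole path toggles exactly A △ B and ends in B, and its difference graph is the
-- sum of the pieces, i.e. H.

open import Defs hiding (sym)
open import Data.Nat using (ℕ; _+_)
open import Data.Nat.Properties using (+-assoc; +-comm; +-identityʳ)
open import Data.Fin using (Fin; _≟_)
open import Data.Fin.Subset using (Subset; _∈_; _∉_; _∪_; ⁅_⁆)
open import Data.Fin.Subset.Properties using (x∈⁅x⁆; x≢y⇒x∉⁅y⁆; x∈p∪q⁺)
open import Data.Vec using (lookup; tabulate; _[_]%=_)
open import Data.Vec.Properties
  using ([]=⇒lookup; lookup⇒[]=; lookup∘updateAt; lookup∘updateAt′; updateAt-updateAt;
         updateAt-id-local; updateAt-commutes; lookup-zipWith; tabulate∘lookup; tabulate-cong)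
open import Data.Bool using (Bool; true; false; not; _∨_)
import Data.Bool as Bool
open import Data.Bool.Properties using (not-involutive; ¬-not; ∨-identityʳ)
open import Data.List using (List; []; _∷_; map)
open import Data.Nat.ListAction using (sum)
open import Data.List.Relation.Unary.All as All using (All; []; _∷_)
open import Data.List.Relation.Unary.All.Properties using (All¬⇒¬Any)
open import Data.List.Relation.Unary.AllPairs using (_∷_)
open import Data.List.Relation.Unary.Any using (here; there; any?)
open import Data.List.Relation.Unary.Unique.Propositional using (Unique)
open import Data.List.Membership.Propositional using () renaming (_∈_ to _∈ₗ_; _∉_ to _∉ₗ_)
open import Data.Maybe using (nothing; just)
open import Data.Product using (Σ; _×_; _,_)
open import Data.Sum using (_⊎_; inj₁; inj₂)
open import Function using (_∘_)
open import Function.Bundles using (_⇔_; Equivalence)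
open import Relation.Nullary using (¬_; yes; no; contradiction)
open import Relation.Binary.PropositionalEquality
open ≡-Reasoning

private
  variable
    n : ℕ
    S T U : Subset n
    d e : Fin n → Fin n → ℕ

lookup-≗⇒≡ : (X Y : Subset n) → (∀ v → lookup X v ≡ lookup Y v) → X ≡ Y
lookup-≗⇒≡ X Y X≗Y = begin
  X                   ≡⟨ tabulate∘lookup X ⟨
  tabulate (lookup X) ≡⟨ tabulate-cong X≗Y ⟩
  tabulate (lookup Y) ≡⟨ tabulate∘lookup Y ⟩
  Y                   ∎

∈⇒lookup≡true : {v : Fin n} → v ∈ S → lookup S v ≡ true
∈⇒lookup≡true = []=⇒lookup

lookup≡false⇒∉ : {v : Fin n} → lookup S v ≡ false → v ∉ S
lookup≡false⇒∉ eq v∈S with trans (sym eq) (∈⇒lookup≡true v∈S)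
... | ()

lookup≡true⇒∈ : {v : Fin n} → lookup S v ≡ true → v ∈ S
lookup≡true⇒∈ = lookup⇒[]= _ _

∉⇒lookup≡false : {v : Fin n} → v ∉ S → lookup S v ≡ false
∉⇒lookup≡false {S = S} {v} v∉S with lookup S v in eq
... | true  = contradiction (lookup≡true⇒∈ eq) v∉S
... | false = refl

∈∉⇒lookup≢ : {p q : Fin n} → p ∈ S → q ∉ S → lookup S p ≢ lookup S q
∈∉⇒lookup≢ p∈S q∉S eq = q∉S (lookup≡true⇒∈ (trans (sym eq) (∈⇒lookup≡true p∈S)))

lookup-∪-∉ : (X : Subset n) {Y : Subset n} {v : Fin n} → v ∉ Y → lookup (X ∪ Y) v ≡ lookup X v
lookup-∪-∉ X {Y} {v} v∉Y = begin
  lookup (X ∪ Y) v          ≡⟨ lookup-zipWith _∨_ v X Y ⟩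
  lookup X v ∨ lookup Y v   ≡⟨ cong (lookup X v ∨_) (∉⇒lookup≡false v∉Y) ⟩
  lookup X v ∨ false        ≡⟨ ∨-identityʳ _ ⟩
  lookup X v                ∎

≡-∪⁅⁆∪⁅⁆ : {r r' : Fin n} → lookup T r ≡ true → lookup T r' ≡ true →
           (∀ v → v ≢ r → v ≢ r' → lookup T v ≡ lookup S v) →
           T ≡ (S ∪ ⁅ r ⁆) ∪ ⁅ r' ⁆
≡-∪⁅⁆∪⁅⁆ {T = T} {S = S} {r} {r'} Tr Tr' T≗S = lookup-≗⇒≡ _ _ pointwise
  where
  S∪rr' : Subset _
  S∪rr' = (S ∪ ⁅ r ⁆) ∪ ⁅ r' ⁆

  pointwise : ∀ v → lookup T v ≡ lookup S∪rr' v
  pointwise v with v ≟ r | v ≟ r'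
  ... | yes refl | _ =
    trans Tr (sym (∈⇒lookup≡true {S = S∪rr'} (x∈p∪q⁺ (inj₁ (x∈p∪q⁺ (inj₂ (x∈⁅x⁆ r)))))))
  ... | no _ | yes refl =
    trans Tr' (sym (∈⇒lookup≡true {S = S∪rr'} (x∈p∪q⁺ (inj₂ (x∈⁅x⁆ r')))))
  ... | no v≢r | no v≢r' = begin
    lookup T v              ≡⟨ T≗S v v≢r v≢r' ⟩
    lookup S v              ≡⟨ lookup-∪-∉ S (x≢y⇒x∉⁅y⁆ v≢r) ⟨
    lookup (S ∪ ⁅ r ⁆) v    ≡⟨ lookup-∪-∉ (S ∪ ⁅ r ⁆) (x≢y⇒x∉⁅y⁆ v≢r') ⟨
    lookup S∪rr' v          ∎

toggle : Fin n → Subset n → Subset n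
toggle i S = S [ i ]%= not

toggleAll : List (Fin n) → Subset n → Subset n
toggleAll []       S = S
toggleAll (v ∷ vs) S = toggleAll vs (toggle v S)

lookup-toggle : (i : Fin n) (S : Subset n) → lookup (toggle i S) i ≡ not (lookup S i)
lookup-toggle i S = lookup∘updateAt i S

lookup-toggle-≢ : {i v : Fin n} → i ≢ v → lookup (toggle i S) v ≡ lookup S v
lookup-toggle-≢ {S = S} {i} {v} i≢v = lookup∘updateAt′ v i (i≢v ∘ sym) S

toggle-involutive : (i : Fin n) (S : Subset n) → toggle i (toggle i S) ≡ S
toggle-involutive i S =
  trans (updateAt-updateAt i S) (updateAt-id-local i S (not-involutive (lookup S i)))

toggle-comm : (i j : Fin n) (S : Subset n) → toggle i (toggle j S) ≡ toggle j (toggle i S)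
toggle-comm i j S with i ≟ j
... | yes refl = refl
... | no i≢j   = updateAt-commutes i j i≢j S

lookup-toggleAll-∉ : (vs : List (Fin n)) {v : Fin n} → v ∉ₗ vs →
                     lookup (toggleAll vs S) v ≡ lookup S v
lookup-toggleAll-∉ []       _   = refl
lookup-toggleAll-∉ {S = S} (w ∷ ws) v∉ =
  trans (lookup-toggleAll-∉ ws (v∉ ∘ there))
        (lookup-toggle-≢ {S = S} (λ w≡v → v∉ (here (sym w≡v))))

lookup-toggleAll-∈ : {vs : List (Fin n)} {v : Fin n} → Unique vs → v ∈ₗ vs →
                     lookup (toggleAll vs S) v ≡ not (lookup S v)
lookup-toggleAll-∈ {S = S} {w ∷ ws} (w∉ws ∷ _) (here refl) =
  trans (lookup-toggleAll-∉ ws (All¬⇒¬Any w∉ws)) (lookup-toggle w S)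
lookup-toggleAll-∈ {S = S} (w∉ws ∷ unique) (there v∈ws) =
  trans (lookup-toggleAll-∈ unique v∈ws)
        (cong not (lookup-toggle-≢ {S = S} (All.lookup w∉ws v∈ws)))

transition-toggle : {r r' : Fin n} → r ≢ r' → lookup S r ≡ lookup S r' →
                    Transition S (toggle r' (toggle r S)) r r'
transition-toggle {S = S} {r} {r'} r≢r' Sr≡Sr' = r≢r' , by-side (lookup S r) refl
  where
  S' : Subset _
  S' = toggle r' (toggle r S)

  S'r : lookup S' r ≡ not (lookup S r)
  S'r = trans (lookup-toggle-≢ {S = toggle r S} (r≢r' ∘ sym)) (lookup-toggle r S)

  S'r' : lookup S' r' ≡ not (lookup S r)
  S'r' = trans (lookup-toggle r' (toggle r S))
               (cong not (trans (lookup-toggle-≢ {S = S} r≢r') (sym Sr≡Sr')))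

  S'≗S : ∀ v → v ≢ r → v ≢ r' → lookup S' v ≡ lookup S v
  S'≗S v v≢r v≢r' =
    trans (lookup-toggle-≢ {S = toggle r S} (v≢r' ∘ sym)) (lookup-toggle-≢ {S = S} (v≢r ∘ sym))

  by-side : (b : Bool) → lookup S r ≡ b →
            (r ∉ S' × r' ∉ S' × S ≡ (S' ∪ ⁅ r ⁆) ∪ ⁅ r' ⁆)
            ⊎ (r ∉ S × r' ∉ S × S' ≡ (S ∪ ⁅ r ⁆) ∪ ⁅ r' ⁆)
  by-side true  Sr = inj₁ ( lookup≡false⇒∉ (trans S'r (cong not Sr))
                          , lookup≡false⇒∉ (trans S'r' (cong not Sr))
                          , ≡-∪⁅⁆∪⁅⁆ Sr (trans (sym Sr≡Sr') Sr) (λ v v≢r v≢r' → sym (S'≗S v v≢r v≢r')) )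
  by-side false Sr = inj₂ ( lookup≡false⇒∉ Sr
                          , lookup≡false⇒∉ (trans (sym Sr≡Sr') Sr)
                          , ≡-∪⁅⁆∪⁅⁆ (trans S'r (cong not Sr)) (trans S'r' (cong not Sr)) S'≗S )

_++ₚ_ : TransitionPath S T → TransitionPath T U → TransitionPath S U
[]             ++ₚ Q = Q
step r r' t P ++ₚ Q = step r r' t (P ++ₚ Q)

diffMult-++ₚ : (P : TransitionPath S T) (Q : TransitionPath T U) (x y : Fin n) →
               diffMult (P ++ₚ Q) x y ≡ diffMult P x y + diffMult Q x y
diffMult-++ₚ []              Q x y = refl
diffMult-++ₚ (step r r' t P) Q x y =
  trans (cong (pairIndicator r r' x y +_) (diffMult-++ₚ P Q x y))
        (sym (+-assoc (pairIndicator r r' x y) _ _))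

DiffPath : Subset n → Subset n → (Fin n → Fin n → ℕ) → Set
DiffPath S T d = Σ (TransitionPath S T) λ P → ∀ x y → diffMult P x y ≡ d x y

single : {r r' : Fin n} → Transition S T r r' → DiffPath S T (pairIndicator r r')
single {r = r} {r'} t = step r r' t [] , λ x y → +-identityʳ _

_++ᵈ_ : DiffPath S T d → DiffPath T U e → DiffPath S U (λ x y → d x y + e x y)
(P , diffP) ++ᵈ (Q , diffQ) =
  P ++ₚ Q , λ x y → trans (diffMult-++ₚ P Q x y) (cong₂ _+_ (diffP x y) (diffQ x y))

cast : {T' : Subset n} → T ≡ T' → (∀ x y → d x y ≡ e x y) → DiffPath S T d → DiffPath S T' e
cast refl d≗e (P , diffP) = P , λ x y → trans (diffP x y) (d≗e x y)

PieceShape : Subset n → PathPiece n → Set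
PieceShape S (piece p q nothing)  = p ≢ q × lookup S p ≡ lookup S q
PieceShape S (piece p q (just s)) = s ≢ p × s ≢ q × lookup S p ≢ lookup S q

validPiece⇒PieceShape : {A B : Subset n} {Q : PathPiece n} → ValidPiece A B Q → PieceShape A Q
validPiece⇒PieceShape {Q = piece p q nothing} (p≢q , inj₁ (inj₁ ((p∈A , _) , (q∈A , _)) , _)) =
  p≢q , trans (∈⇒lookup≡true p∈A) (sym (∈⇒lookup≡true q∈A))
validPiece⇒PieceShape {Q = piece p q nothing} (p≢q , inj₁ (inj₂ ((_ , p∉A) , (_ , q∉A)) , _)) =
  p≢q , trans (∉⇒lookup≡false p∉A) (sym (∉⇒lookup≡false q∉A))
validPiece⇒PieceShape {Q = piece p q nothing} (_ , inj₂ (_ , _ , () , _))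
validPiece⇒PieceShape {Q = piece p q (just s)} (_ , inj₁ (_ , ()))
validPiece⇒PieceShape {Q = piece p q (just s)}
  (_ , inj₂ (inj₁ ((p∈A , _) , (_ , q∉A)) , _ , refl , s≢p , s≢q)) =
  s≢p , s≢q , ∈∉⇒lookup≢ p∈A q∉A
validPiece⇒PieceShape {Q = piece p q (just s)}
  (_ , inj₂ (inj₂ ((_ , p∉A) , (q∈A , _)) , _ , refl , s≢p , s≢q)) =
  s≢p , s≢q , ∈∉⇒lookup≢ q∈A p∉A ∘ sym

PieceShape-cong : (Q : PathPiece n) → lookup T (pEnd Q) ≡ lookup S (pEnd Q) →
                  lookup T (qEnd Q) ≡ lookup S (qEnd Q) → PieceShape S Q → PieceShape T Q
PieceShape-cong (piece p q nothing) Tp≡Sp Tq≡Sq (p≢q , Sp≡Sq) =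
  p≢q , trans Tp≡Sp (trans Sp≡Sq (sym Tq≡Sq))
PieceShape-cong (piece p q (just s)) Tp≡Sp Tq≡Sq (s≢p , s≢q , Sp≢Sq) =
  s≢p , s≢q , λ Tp≡Tq → Sp≢Sq (trans (sym Tp≡Sp) (trans Tp≡Tq Tq≡Sq))

All-PieceShape-cong : (Qs : List (PathPiece n)) →
                      (∀ v → v ∈ₗ endpoints Qs → lookup T v ≡ lookup S v) →
                      All (PieceShape S) Qs → All (PieceShape T) Qs
All-PieceShape-cong []                  _   []               = []
All-PieceShape-cong (piece p q m ∷ Qs) T≗S (shape ∷ shapes) =
  PieceShape-cong (piece p q m) (T≗S p (here refl)) (T≗S q (there (here refl))) shape
  ∷ All-PieceShape-cong Qs (λ v → T≗S v ∘ there ∘ there) shapes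

realisePiece : (Q : PathPiece n) → PieceShape S Q →
               DiffPath S (toggle (qEnd Q) (toggle (pEnd Q) S)) (pieceMult Q)
realisePiece (piece p q nothing) (p≢q , Sp≡Sq) = single (transition-toggle p≢q Sp≡Sq)
realisePiece {S = S} (piece p q (just s)) (s≢p , s≢q , Sp≢Sq) with lookup S s Bool.≟ lookup S p
... | yes Ss≡Sp =
  cast (cong (toggle q) (toggle-involutive s (toggle p S))) (λ _ _ → refl)
       (single (transition-toggle (s≢p ∘ sym) (sym Ss≡Sp)) ++ᵈ single (transition-toggle s≢q s-q-agree))
  where
  S₁ : Subset _
  S₁ = toggle s (toggle p S)

  s-q-agree : lookup S₁ s ≡ lookup S₁ q
  s-q-agree = begin
    lookup S₁ s                    ≡⟨ lookup-toggle s (toggle p S) ⟩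
    not (lookup (toggle p S) s)    ≡⟨ cong not (lookup-toggle-≢ {S = S} (s≢p ∘ sym)) ⟩
    not (lookup S s)               ≡⟨ cong not Ss≡Sp ⟩
    not (lookup S p)               ≡⟨ ¬-not (Sp≢Sq ∘ sym) ⟨
    lookup S q                     ≡⟨ lookup-toggle-≢ {S = S} (Sp≢Sq ∘ cong (lookup S)) ⟨
    lookup (toggle p S) q          ≡⟨ lookup-toggle-≢ {S = toggle p S} s≢q ⟨
    lookup S₁ q                    ∎
... | no Ss≢Sp =
  cast toggles-cancel (λ x y → +-comm (pairIndicator s q x y) _)
       (single (transition-toggle s≢q Ss≡Sq) ++ᵈ single (transition-toggle (s≢p ∘ sym) p-s-agree))
  where
  S₁ : Subset _
  S₁ = toggle q (toggle s S)

  q≢p : q ≢ p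
  q≢p q≡p = Sp≢Sq (cong (lookup S) (sym q≡p))

  Ss≡Sq : lookup S s ≡ lookup S q
  Ss≡Sq = trans (¬-not Ss≢Sp) (sym (¬-not (Sp≢Sq ∘ sym)))

  p-s-agree : lookup S₁ p ≡ lookup S₁ s
  p-s-agree = begin
    lookup S₁ p                    ≡⟨ lookup-toggle-≢ {S = toggle s S} q≢p ⟩
    lookup (toggle s S) p          ≡⟨ lookup-toggle-≢ {S = S} s≢p ⟩
    lookup S p                     ≡⟨ ¬-not (Ss≢Sp ∘ sym) ⟩
    not (lookup S s)               ≡⟨ lookup-toggle s S ⟨
    lookup (toggle s S) s          ≡⟨ lookup-toggle-≢ {S = toggle s S} (s≢q ∘ sym) ⟨
    lookup S₁ s                    ∎

  toggles-cancel : toggle s (toggle p S₁) ≡ toggle q (toggle p S)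
  toggles-cancel = begin
    toggle s (toggle p (toggle q (toggle s S)))  ≡⟨ cong (toggle s ∘ toggle p) (toggle-comm q s S) ⟩
    toggle s (toggle p (toggle s (toggle q S)))  ≡⟨ cong (toggle s) (toggle-comm p s _) ⟩
    toggle s (toggle s (toggle p (toggle q S)))  ≡⟨ toggle-involutive s _ ⟩
    toggle p (toggle q S)                        ≡⟨ toggle-comm p q S ⟩
    toggle q (toggle p S)                        ∎

realisePieces : (Qs : List (PathPiece n)) → Unique (endpoints Qs) → All (PieceShape S) Qs →
                DiffPath S (toggleAll (endpoints Qs) S) (λ x y → sum (map (λ Q → pieceMult Q x y) Qs))
realisePieces [] _ [] = [] , λ _ _ → refl
realisePieces {S = S} (piece p q m ∷ Qs) ((_ ∷ p∉Qs) ∷ q∉Qs ∷ unique) (shape ∷ shapes) =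
  realisePiece (piece p q m) shape
  ++ᵈ realisePieces Qs unique (All-PieceShape-cong Qs untouched shapes)
  where
  untouched : ∀ v → v ∈ₗ endpoints Qs → lookup (toggle q (toggle p S)) v ≡ lookup S v
  untouched v v∈Qs = trans (lookup-toggle-≢ {S = toggle p S} (All.lookup q∉Qs v∈Qs))
                           (lookup-toggle-≢ {S = S} (All.lookup p∉Qs v∈Qs))

∈△⇒lookup≡not : {A B : Subset n} {v : Fin n} → v ∈△ A , B → lookup B v ≡ not (lookup A v)
∈△⇒lookup≡not (inj₁ (v∈A , v∉B)) = trans (∉⇒lookup≡false v∉B) (cong not (sym (∈⇒lookup≡true v∈A)))
∈△⇒lookup≡not (inj₂ (v∈B , v∉A)) = trans (∈⇒lookup≡true v∈B) (cong not (sym (∉⇒lookup≡false v∉A)))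

∉△⇒lookup≡ : {A B : Subset n} {v : Fin n} → ¬ (v ∈△ A , B) → lookup A v ≡ lookup B v
∉△⇒lookup≡ {A = A} {B} {v} v∉△ with lookup A v in eqA | lookup B v in eqB
... | true  | true  = refl
... | false | false = refl
... | true  | false = contradiction (inj₁ (lookup≡true⇒∈ eqA , lookup≡false⇒∉ eqB)) v∉△
... | false | true  = contradiction (inj₂ (lookup≡true⇒∈ eqB , lookup≡false⇒∉ eqA)) v∉△

toggleAll-△ : {A B : Subset n} {vs : List (Fin n)} → Unique vs →
              (∀ v → (v ∈ₗ vs) ⇔ (v ∈△ A , B)) → toggleAll vs A ≡ B
toggleAll-△ {A = A} {B} {vs} unique vs⇔△ = lookup-≗⇒≡ _ _ pointwise
  where
  pointwise : ∀ v → lookup (toggleAll vs A) v ≡ lookup B v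
  pointwise v with any? (v ≟_) vs
  ... | yes v∈vs = trans (lookup-toggleAll-∈ unique v∈vs)
                         (sym (∈△⇒lookup≡not (Equivalence.to (vs⇔△ v) v∈vs)))
  ... | no v∉vs  = trans (lookup-toggleAll-∉ vs v∉vs)
                         (∉△⇒lookup≡ (v∉vs ∘ Equivalence.from (vs⇔△ v)))

proposition16 : ∀ {n : ℕ} (A B : State n) (H : Multigraph n) →
                IsDifferenceGraph A B H → IsCanonical A B H →
                Realisable A B H
proposition16 A B H _ (Qs , valid , unique , endpoints⇔△ , H≡ΣQs) =
  cast (toggleAll-△ unique endpoints⇔△) (λ x y → sym (H≡ΣQs x y))
       (realisePieces Qs unique (All.map validPiece⇒PieceShape valid))
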